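{- Let $K$ be a field and let $f(X)\in K[X]$ be an irreducible polynomial of degree $d\ge 3$ over $K$. Then there exists a polynomial $h(X)\in K[X]$ of degree at most $d-1$ such that the composition $f(h(X))$ is reducible over $K$. -}

module Defs where

open import Level using (Level; _⊔_; suc)
open import Algebra.Bundles using (CommutativeRing)
open import Data.Nat as ℕ using (ℕ; zero; suc; _<_; _≤_)
open import Data.List using (List; []; _∷_)
open import Data.Product using (Σ; ∃; ∃-syntax; _×_; _,_)
open import Data.Sum using (_⊎_)
open import Relation.Nullary using (¬_)

record Field (c ℓ : Level) : Set (Level.suc (c ⊔ ℓ)) where
  field
    commutativeRing : CommutativeRing c ℓ
  open CommutativeRing commutativeRing public
  field
    1≉0     : ¬ (1# ≈ 0#)
    inverse : ∀ x → ¬ (x ≈ 0#) → ∃[ y ] (x * y ≈ 1#)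

-- Univariate polynomials over K, represented by coefficient lists
-- (lowest degree first); trailing zero coefficients are allowed,
-- so polynomial equality is coefficientwise setoid equality.
module Poly {c ℓ : Level} (K : Field c ℓ) where
  open Field K

  Pol : Set c
  Pol = List Carrier

  coeff : Pol → ℕ → Carrier
  coeff []       _       = 0#
  coeff (a ∷ p)  zero    = a
  coeff (a ∷ p)  (suc i) = coeff p i

  infix 4 _≈P_
  _≈P_ : Pol → Pol → Set ℓ
  p ≈P q = ∀ i → coeff p i ≈ coeff q i

  infixl 6 _+P_
  _+P_ : Pol → Pol → Pol
  []      +P q       = q
  (a ∷ p) +P []      = a ∷ p
  (a ∷ p) +P (b ∷ q) = (a + b) ∷ (p +P q)

  _·P_ : Carrier → Pol → Pol
  a ·P []      = []
  a ·P (b ∷ q) = (a * b) ∷ (a ·P q)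

  infixl 7 _*P_
  _*P_ : Pol → Pol → Pol
  []      *P q = []
  (a ∷ p) *P q = (a ·P q) +P (0# ∷ (p *P q))

  _∘P_ : Pol → Pol → Pol
  []      ∘P h = []
  (a ∷ f) ∘P h = (a ∷ []) +P (h *P (f ∘P h))

  -- deg p ≤ n  (the zero polynomial has degree ≤ n for every n)
  DegreeAtMost : Pol → ℕ → Set ℓ
  DegreeAtMost p n = ∀ i → n < i → coeff p i ≈ 0#

  HasDegree : Pol → ℕ → Set ℓ
  HasDegree p n = ¬ (coeff p n ≈ 0#) × DegreeAtMost p n

  -- p is a nonzero constant, i.e. a unit of K[X]
  IsUnit : Pol → Set ℓ
  IsUnit p = ¬ (coeff p 0 ≈ 0#) × DegreeAtMost p 0

  Nonconstant : Pol → Set ℓ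
  Nonconstant p = ∃[ i ] (1 ≤ i × ¬ (coeff p i ≈ 0#))

  -- irreducible: nonzero, nonunit (i.e. nonconstant over a field), and
  -- in every factorisation one of the factors is a unit
  Irreducible : Pol → Set (c ⊔ ℓ)
  Irreducible f = Nonconstant f × (∀ g k → f ≈P g *P k → IsUnit g ⊎ IsUnit k)

  Reducible : Pol → Set (c ⊔ ℓ)
  Reducible f = ∃[ g ] ∃[ k ] (Nonconstant g × Nonconstant k × f ≈P g *P k)

{-# OPTIONS --safe #-}

-- Write f = a₀ + a₁X + ⋯ + a_d X^d and let f* = X^d f(1/X) = a_d + a_{d-1}X + ⋯ + a₀X^d be its
-- reversal.  Irreducibility forces a₀ ≉ 0, so f* has degree d.  Writing f* = a_d + X g, the
-- polynomial h = -a_d⁻¹ g has degree d - 1 and X h ≡ 1 modulo f*.  In any commutative ring,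
-- y x ≡ 1 modulo v implies F(y) ≡ y^n F*(x) modulo v for F of degree ≤ n; with y = h, x = X and
-- v = f* in K[X] this shows that f* divides f(h).  As deg f(h) = d(d - 1) > d = deg f*, the
-- cofactor is nonconstant as well.

module Submission where

open import Level using (Level)
open import Algebra.Bundles using (CommutativeRing)
open import Data.List using (List; []; _∷_; length; map; applyUpTo; applyDownFrom)
open import Data.List.Properties using (map-applyUpTo)
open import Data.Nat as ℕ using (ℕ; zero; suc; _≤_; _∸_; s≤s; z≤n)
import Data.Nat.Properties as ℕ
open import Data.Product using (∃-syntax; _×_; _,_; proj₁; proj₂)
open import Data.Sum using (inj₁; inj₂)
open import Function using (_∘_; case_of_)
open import Relation.Binary.Bundles using (Setoid)
open import Relation.Binary.PropositionalEquality as ≡ using (_≡_)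
import Relation.Binary.Reasoning.Setoid
open import Relation.Nullary using (¬_; yes; no)

open import Defs

module HornerReversal {r ℓ : Level} (R : CommutativeRing r ℓ) where

  open CommutativeRing R
  open import Algebra.Properties.CommutativeSemiring.Exp commutativeSemiring using (_^_; ^-distrib-*)
  open import Algebra.Solver.Ring.NaturalCoefficients.Default commutativeSemiring
    using (solve; _:=_; _:+_; _:*_; con)
  open import Relation.Binary.Reasoning.Setoid setoid

  horner : List Carrier → Carrier → Carrier
  horner []       y = 0#
  horner (c ∷ cs) y = c + y * horner cs y

  1-w^n-divisible : ∀ {w v} → w + v ≈ 1# → ∀ n → ∃[ s ] 1# ≈ w ^ n + v * s
  1-w^n-divisible {v = v} w+v≈1 zero = 0# , sym (trans (+-congˡ (zeroʳ v)) (+-identityʳ 1#))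
  1-w^n-divisible {w} {v} w+v≈1 (suc n) with 1-w^n-divisible w+v≈1 n
  ... | s , 1≈w^n+vs = 1# + w * s , (begin
    1#                        ≈⟨ sym w+v≈1 ⟩
    w + v                     ≈⟨ +-congʳ (trans (sym (*-identityʳ w)) (*-congˡ 1≈w^n+vs)) ⟩
    w * (w ^ n + v * s) + v
      ≈⟨ solve 4 (λ w v p s → w :* (p :+ v :* s) :+ v := w :* p :+ v :* (con 1 :+ w :* s))
               refl w v (w ^ n) s ⟩
    w * w ^ n + v * (1# + w * s) ∎)

  horner-applyDownFrom-suc : ∀ m g x →
    horner (applyDownFrom g (suc m)) x ≈ horner (applyDownFrom (g ∘ suc) m) x + g 0 * x ^ m
  horner-applyDownFrom-suc zero    g x = begin
    g 0 + x * 0#  ≈⟨ +-congˡ (zeroʳ x) ⟩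
    g 0 + 0#      ≈⟨ +-comm (g 0) 0# ⟩
    0# + g 0      ≈⟨ +-congˡ (sym (*-identityʳ (g 0))) ⟩
    0# + g 0 * 1# ∎
  horner-applyDownFrom-suc (suc m) g x = begin
    g (suc m) + x * horner (applyDownFrom g (suc m)) x
      ≈⟨ +-congˡ (*-congˡ (horner-applyDownFrom-suc m g x)) ⟩
    g (suc m) + x * (b + g 0 * x ^ m)
      ≈⟨ solve 5 (λ a x b c p → a :+ x :* (b :+ c :* p) := (a :+ x :* b) :+ c :* (x :* p))
               refl (g (suc m)) x b (g 0) (x ^ m) ⟩
    (g (suc m) + x * b) + g 0 * (x * x ^ m) ∎
    where
    b : Carrier
    b = horner (applyDownFrom (g ∘ suc) m) x

  horner-reversal : ∀ {x y v} → y * x + v ≈ 1# → ∀ n g → ∃[ q ]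
    horner (applyUpTo g (suc n)) y ≈ y ^ n * horner (applyDownFrom g (suc n)) x + v * q
  horner-reversal {x} {y} {v} yx+v≈1 zero g = 0# , (begin
    g 0 + y * 0#                  ≈⟨ +-congˡ (zeroʳ y) ⟩
    g 0 + 0#                      ≈⟨ +-cong (*-identityˡ (g 0)) (zeroʳ v) ⟨
    1# * g 0 + v * 0#             ≈⟨ +-congʳ (*-congˡ (trans (+-congˡ (zeroʳ x)) (+-identityʳ (g 0)))) ⟨
    1# * (g 0 + x * 0#) + v * 0#  ∎)
  horner-reversal {x} {y} {v} yx+v≈1 (suc n) g
    with horner-reversal yx+v≈1 n (g ∘ suc) | 1-w^n-divisible yx+v≈1 (suc n)
  ... | q , ih | s , 1≈[yx]^n+vs = g 0 * s + y * q , (begin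
    g 0 + y * horner (applyUpTo (g ∘ suc) (suc n)) y
      ≈⟨ +-cong (trans (sym (*-identityʳ (g 0))) (*-congˡ 1≈[yx]^n+vs)) (*-congˡ ih) ⟩
    g 0 * ((y * x) ^ suc n + v * s) + y * (y ^ n * b + v * q)
      ≈⟨ +-congʳ (*-congˡ (+-congʳ (^-distrib-* y x (suc n)))) ⟩
    g 0 * (y * y ^ n * (x * x ^ n) + v * s) + y * (y ^ n * b + v * q)
      ≈⟨ solve 9 (λ a y p x r v s q b →
                   a :* (y :* p :* (x :* r) :+ v :* s) :+ y :* (p :* b :+ v :* q)
                := y :* p :* (b :+ a :* (x :* r)) :+ v :* (a :* s :+ y :* q))
               refl (g 0) y (y ^ n) x (x ^ n) v s q b ⟩
    y * y ^ n * (b + g 0 * (x * x ^ n)) + v * (g 0 * s + y * q)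
      ≈⟨ +-congʳ (*-congˡ (sym (horner-applyDownFrom-suc (suc n) g x))) ⟩
    y * y ^ n * horner (applyDownFrom g (suc (suc n))) x + v * (g 0 * s + y * q) ∎)
    where
    b : Carrier
    b = horner (applyDownFrom (g ∘ suc) (suc n)) x

  reversal-divides-horner : ∀ {x y a} n g → y * x + a * horner (applyDownFrom g (suc n)) x ≈ 1# →
    ∃[ k ] horner (applyUpTo g (suc n)) y ≈ horner (applyDownFrom g (suc n)) x * k
  reversal-divides-horner {x} {y} {a} n g bezout with horner-reversal bezout n g
  ... | q , eq = y ^ n + a * q , trans eq
    (solve 4 (λ p r a q → p :* r :+ (a :* r) :* q := r :* (p :+ a :* q))
           refl (y ^ n) (horner (applyDownFrom g (suc n)) x) a q)

module PolynomialRing {c ℓ : Level} (K : Field c ℓ) where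

  open Field K hiding (zero)
  open Poly K
  open import Algebra.Properties.Ring ring using (-1*x≈-x)
  open import Algebra.Solver.Ring.NaturalCoefficients.Default commutativeSemiring
    using (solve; _:=_; _:+_; _:*_)
  module ≈-Reasoning = Relation.Binary.Reasoning.Setoid setoid

  -- A record around _≈P_, so that both polynomials can be inferred from an equation.
  infix 4 _≋_
  record _≋_ (p q : Pol) : Set ℓ where
    constructor ≈P⇒≋
    field ≋⇒≈P : p ≈P q
  open _≋_ public

  ≋-refl : ∀ {p} → p ≋ p
  ≋-refl = ≈P⇒≋ λ i → refl

  ≋-sym : ∀ {p q} → p ≋ q → q ≋ p
  ≋-sym p≋q = ≈P⇒≋ λ i → sym (≋⇒≈P p≋q i)

  ≋-trans : ∀ {p q r} → p ≋ q → q ≋ r → p ≋ r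
  ≋-trans p≋q q≋r = ≈P⇒≋ λ i → trans (≋⇒≈P p≋q i) (≋⇒≈P q≋r i)

  ≋-setoid : Setoid c ℓ
  ≋-setoid = record
    { _≈_           = _≋_
    ; isEquivalence = record { refl = ≋-refl ; sym = ≋-sym ; trans = ≋-trans }
    }

  module ≋-Reasoning = Relation.Binary.Reasoning.Setoid ≋-setoid

  ∷-cong : ∀ {a b p q} → a ≈ b → p ≋ q → a ∷ p ≋ b ∷ q
  ∷-cong a≈b p≋q = ≈P⇒≋ λ { zero → a≈b ; (suc i) → ≋⇒≈P p≋q i }

  ∷-≋-∷⇒≋ : ∀ {a b p q} → a ∷ p ≋ b ∷ q → p ≋ q
  ∷-≋-∷⇒≋ e = ≈P⇒≋ λ i → ≋⇒≈P e (suc i)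

  ∷-≋-[]⇒≋ : ∀ {a p} → a ∷ p ≋ [] → p ≋ []
  ∷-≋-[]⇒≋ e = ≈P⇒≋ λ i → ≋⇒≈P e (suc i)

  coeff-+P : ∀ p q i → coeff (p +P q) i ≈ coeff p i + coeff q i
  coeff-+P []      q       i       = sym (+-identityˡ _)
  coeff-+P (a ∷ p) []      i       = sym (+-identityʳ _)
  coeff-+P (a ∷ p) (b ∷ q) zero    = refl
  coeff-+P (a ∷ p) (b ∷ q) (suc i) = coeff-+P p q i

  coeff-·P : ∀ a p i → coeff (a ·P p) i ≈ a * coeff p i
  coeff-·P a []      i       = sym (zeroʳ a)
  coeff-·P a (b ∷ p) zero    = refl
  coeff-·P a (b ∷ p) (suc i) = coeff-·P a p i

  coeff-∷*P : ∀ a p q i → coeff ((a ∷ p) *P q) i ≈ a * coeff q i + coeff (0# ∷ p *P q) i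
  coeff-∷*P a p q i = trans (coeff-+P (a ·P q) _ i) (+-congʳ (coeff-·P a q i))

  +P-cong : ∀ {p p′ q q′} → p ≋ p′ → q ≋ q′ → p +P q ≋ p′ +P q′
  +P-cong {p} {p′} {q} {q′} p≋p′ q≋q′ = ≈P⇒≋ λ i → begin
    coeff (p +P q) i          ≈⟨ coeff-+P p q i ⟩
    coeff p i + coeff q i     ≈⟨ +-cong (≋⇒≈P p≋p′ i) (≋⇒≈P q≋q′ i) ⟩
    coeff p′ i + coeff q′ i   ≈⟨ coeff-+P p′ q′ i ⟨
    coeff (p′ +P q′) i        ∎
    where open ≈-Reasoning

  ·P-cong : ∀ {a b p q} → a ≈ b → p ≋ q → a ·P p ≋ b ·P q
  ·P-cong {a} {b} {p} {q} a≈b p≋q = ≈P⇒≋ λ i →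
    trans (coeff-·P a p i) (trans (*-cong a≈b (≋⇒≈P p≋q i)) (sym (coeff-·P b q i)))

  +P-identityʳ : ∀ p → p +P [] ≋ p
  +P-identityʳ p = ≈P⇒≋ λ i → trans (coeff-+P p [] i) (+-identityʳ _)

  +P-comm : ∀ p q → p +P q ≋ q +P p
  +P-comm p q = ≈P⇒≋ λ i → trans (coeff-+P p q i) (trans (+-comm _ _) (sym (coeff-+P q p i)))

  +P-assoc : ∀ p q r → (p +P q) +P r ≋ p +P (q +P r)
  +P-assoc p q r = ≈P⇒≋ λ i → begin
    coeff ((p +P q) +P r) i
      ≈⟨ trans (coeff-+P (p +P q) r i) (+-congʳ (coeff-+P p q i)) ⟩
    (coeff p i + coeff q i) + coeff r i
      ≈⟨ +-assoc _ _ _ ⟩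
    coeff p i + (coeff q i + coeff r i)
      ≈⟨ trans (coeff-+P p (q +P r) i) (+-congˡ (coeff-+P q r i)) ⟨
    coeff (p +P (q +P r)) i                 ∎
    where open ≈-Reasoning

  -P_ : Pol → Pol
  -P p = (- 1#) ·P p

  -P-inverseˡ : ∀ p → (-P p) +P p ≋ []
  -P-inverseˡ p = ≈P⇒≋ λ i →
    trans (coeff-+P (-P p) p i)
          (trans (+-congʳ (trans (coeff-·P (- 1#) p i) (-1*x≈-x _))) (-‿inverseˡ _))

  -P-inverseʳ : ∀ p → p +P (-P p) ≋ []
  -P-inverseʳ p = ≋-trans (+P-comm p (-P p)) (-P-inverseˡ p)

  ∷-≋-[] : ∀ {a p} → a ≈ 0# → p ≋ [] → a ∷ p ≋ []
  ∷-≋-[] a≈0 p≋[] = ≈P⇒≋ λ { zero → a≈0 ; (suc i) → ≋⇒≈P p≋[] i }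

  0∷-+P : ∀ p q → 0# ∷ (p +P q) ≋ (0# ∷ p) +P (0# ∷ q)
  0∷-+P p q = ∷-cong (sym (+-identityʳ 0#)) ≋-refl

  0·P : ∀ p → 0# ·P p ≋ []
  0·P p = ≈P⇒≋ λ i → trans (coeff-·P 0# p i) (zeroˡ _)

  *P-zeroʳ : ∀ p → p *P [] ≋ []
  *P-zeroʳ []      = ≋-refl
  *P-zeroʳ (a ∷ p) = ∷-≋-[] refl (*P-zeroʳ p)

  *P-[]ˡ : ∀ {p} q → p ≋ [] → p *P q ≋ []
  *P-[]ˡ {[]}    q p≋[] = ≋-refl
  *P-[]ˡ {a ∷ p} q p≋[] = +P-cong (≋-trans (·P-cong (≋⇒≈P p≋[] 0) ≋-refl) (0·P q))
                                  (∷-≋-[] refl (*P-[]ˡ q (∷-≋-[]⇒≋ p≋[])))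

  +P-left-comm : ∀ p q r → p +P (q +P r) ≋ q +P (p +P r)
  +P-left-comm p q r = begin
    p +P (q +P r)  ≈⟨ +P-assoc p q r ⟨
    (p +P q) +P r  ≈⟨ +P-cong (+P-comm p q) ≋-refl ⟩
    (q +P p) +P r  ≈⟨ +P-assoc q p r ⟩
    q +P (p +P r)  ∎
    where open ≋-Reasoning

  +P-interchange : ∀ p q r s → (p +P q) +P (r +P s) ≋ (p +P r) +P (q +P s)
  +P-interchange p q r s = begin
    (p +P q) +P (r +P s)  ≈⟨ +P-assoc p q (r +P s) ⟩
    p +P (q +P (r +P s))  ≈⟨ +P-cong {p} ≋-refl (+P-left-comm q r s) ⟩
    p +P (r +P (q +P s))  ≈⟨ +P-assoc p r (q +P s) ⟨
    (p +P r) +P (q +P s)  ∎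
    where open ≋-Reasoning

  ·P-distribʳ : ∀ p a b → (a + b) ·P p ≋ a ·P p +P b ·P p
  ·P-distribʳ p a b = ≈P⇒≋ λ i → begin
    coeff ((a + b) ·P p) i         ≈⟨ coeff-·P (a + b) p i ⟩
    (a + b) * coeff p i            ≈⟨ distribʳ (coeff p i) a b ⟩
    a * coeff p i + b * coeff p i
      ≈⟨ trans (coeff-+P (a ·P p) _ i) (+-cong (coeff-·P a p i) (coeff-·P b p i)) ⟨
    coeff (a ·P p +P b ·P p) i              ∎
    where open ≈-Reasoning

  ·P-*P : ∀ a p q → (a ·P p) *P q ≋ a ·P (p *P q)
  ·P-*P a []      q = ≋-refl
  ·P-*P a (b ∷ p) q = ≈P⇒≋ λ i → begin
    coeff ((a * b) ·P q +P (0# ∷ (a ·P p) *P q)) i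
      ≈⟨ coeff-∷*P (a * b) (a ·P p) q i ⟩
    (a * b) * coeff q i + coeff (0# ∷ (a ·P p) *P q) i
      ≈⟨ +-congˡ (≋⇒≈P (∷-cong (sym (zeroʳ a)) (·P-*P a p q)) i) ⟩
    (a * b) * coeff q i + coeff (a ·P (0# ∷ p *P q)) i
      ≈⟨ +-congˡ (coeff-·P a (0# ∷ p *P q) i) ⟩
    (a * b) * coeff q i + a * coeff (0# ∷ p *P q) i
      ≈⟨ solve 4 (λ a b x y → (a :* b) :* x :+ a :* y := a :* (b :* x :+ y))
               refl a b (coeff q i) (coeff (0# ∷ p *P q) i) ⟩
    a * (b * coeff q i + coeff (0# ∷ p *P q) i)
      ≈⟨ trans (coeff-·P a ((b ∷ p) *P q) i) (*-congˡ (coeff-∷*P b p q i)) ⟨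
    coeff (a ·P ((b ∷ p) *P q)) i ∎
    where open ≈-Reasoning

  *P-congʳ : ∀ p {q q′} → q ≋ q′ → p *P q ≋ p *P q′
  *P-congʳ []      q≋q′ = ≋-refl
  *P-congʳ (a ∷ p) q≋q′ = +P-cong (·P-cong refl q≋q′) (∷-cong refl (*P-congʳ p q≋q′))

  *P-congˡ : ∀ {p p′} q → p ≋ p′ → p *P q ≋ p′ *P q
  *P-congˡ {[]}    {p′}     q p≋p′ = ≋-sym (*P-[]ˡ q (≋-sym p≋p′))
  *P-congˡ {a ∷ p} {[]}     q p≋p′ = *P-[]ˡ q p≋p′
  *P-congˡ {a ∷ p} {b ∷ p′} q p≋p′ =
    +P-cong (·P-cong (≋⇒≈P p≋p′ 0) ≋-refl) (∷-cong refl (*P-congˡ q (∷-≋-∷⇒≋ p≋p′)))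

  *P-cong : ∀ {p p′ q q′} → p ≋ p′ → q ≋ q′ → p *P q ≋ p′ *P q′
  *P-cong {p′ = p′} {q = q} p≋p′ q≋q′ = ≋-trans (*P-congˡ q p≋p′) (*P-congʳ p′ q≋q′)

  *P-distribʳ : ∀ q p p′ → (p +P p′) *P q ≋ p *P q +P p′ *P q
  *P-distribʳ q []      p′       = ≋-refl
  *P-distribʳ q (a ∷ p) []       = ≋-sym (+P-identityʳ _)
  *P-distribʳ q (a ∷ p) (b ∷ p′) = begin
    (a + b) ·P q +P (0# ∷ (p +P p′) *P q)
      ≈⟨ +P-cong (·P-distribʳ q a b)
                 (≋-trans (∷-cong refl (*P-distribʳ q p p′)) (0∷-+P (p *P q) (p′ *P q))) ⟩
    (a ·P q +P b ·P q) +P ((0# ∷ p *P q) +P (0# ∷ p′ *P q))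
      ≈⟨ +P-interchange (a ·P q) (b ·P q) (0# ∷ p *P q) (0# ∷ p′ *P q) ⟩
    (a ·P q +P (0# ∷ p *P q)) +P (b ·P q +P (0# ∷ p′ *P q)) ∎
    where open ≋-Reasoning

  0∷-*P : ∀ p q → (0# ∷ p) *P q ≋ 0# ∷ (p *P q)
  0∷-*P p q = +P-cong (0·P q) ≋-refl

  *P-assoc : ∀ p q r → (p *P q) *P r ≋ p *P (q *P r)
  *P-assoc []      q r = ≋-refl
  *P-assoc (a ∷ p) q r = begin
    (a ·P q +P (0# ∷ p *P q)) *P r            ≈⟨ *P-distribʳ r (a ·P q) _ ⟩
    (a ·P q) *P r +P (0# ∷ p *P q) *P r       ≈⟨ +P-cong (·P-*P a q r) (0∷-*P (p *P q) r) ⟩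
    a ·P (q *P r) +P (0# ∷ (p *P q) *P r)     ≈⟨ +P-cong ≋-refl (∷-cong refl (*P-assoc p q r)) ⟩
    a ·P (q *P r) +P (0# ∷ p *P (q *P r))     ∎
    where open ≋-Reasoning

  *P-∷ʳ : ∀ p b q → p *P (b ∷ q) ≋ b ·P p +P (0# ∷ p *P q)
  *P-∷ʳ []      b q = ≋-sym (∷-≋-[] refl ≋-refl)
  *P-∷ʳ (a ∷ p) b q = begin
    (a * b + 0#) ∷ (a ·P q +P p *P (b ∷ q))
      ≈⟨ ∷-cong (+-congʳ (*-comm a b)) (+P-cong ≋-refl (*P-∷ʳ p b q)) ⟩
    (b * a + 0#) ∷ (a ·P q +P (b ·P p +P (0# ∷ p *P q)))
      ≈⟨ ∷-cong refl (+P-left-comm (a ·P q) (b ·P p) _) ⟩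
    (b * a + 0#) ∷ (b ·P p +P (a ·P q +P (0# ∷ p *P q)))  ∎
    where open ≋-Reasoning

  *P-comm : ∀ p q → p *P q ≋ q *P p
  *P-comm []      q = ≋-sym (*P-zeroʳ q)
  *P-comm (a ∷ p) q = ≋-trans (+P-cong ≋-refl (∷-cong refl (*P-comm p q))) (≋-sym (*P-∷ʳ q a p))

  *P-distribˡ : ∀ p q q′ → p *P (q +P q′) ≋ p *P q +P p *P q′
  *P-distribˡ p q q′ = begin
    p *P (q +P q′)         ≈⟨ *P-comm p _ ⟩
    (q +P q′) *P p         ≈⟨ *P-distribʳ p q q′ ⟩
    q *P p +P q′ *P p      ≈⟨ +P-cong (*P-comm q p) (*P-comm q′ p) ⟩
    p *P q +P p *P q′      ∎
    where open ≋-Reasoning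

  1P : Pol
  1P = 1# ∷ []

  *P-identityˡ : ∀ p → 1P *P p ≋ p
  *P-identityˡ p = ≈P⇒≋ λ i → begin
    coeff (1P *P p) i                   ≈⟨ coeff-∷*P 1# [] p i ⟩
    1# * coeff p i + coeff (0# ∷ []) i  ≈⟨ +-cong (*-identityˡ _) (≋⇒≈P (∷-≋-[] refl ≋-refl) i) ⟩
    coeff p i + 0#                      ≈⟨ +-identityʳ _ ⟩
    coeff p i                           ∎
    where open ≈-Reasoning

  *P-identityʳ : ∀ p → p *P 1P ≋ p
  *P-identityʳ p = ≋-trans (*P-comm p 1P) (*P-identityˡ p)

  polynomialRing : CommutativeRing c ℓ
  polynomialRing = record
    { Carrier = Pol
    ; _≈_ = _≋_
    ; _+_ = _+P_
    ; _*_ = _*P_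
    ; -_ = -P_
    ; 0# = []
    ; 1# = 1P
    ; isCommutativeRing = record
      { isRing = record
        { +-isAbelianGroup = record
          { isGroup = record
            { isMonoid = record
              { isSemigroup = record
                { isMagma = record { isEquivalence = Setoid.isEquivalence ≋-setoid ; ∙-cong = +P-cong }
                ; assoc = +P-assoc }
              ; identity = (λ p → ≋-refl) , +P-identityʳ }
            ; inverse = -P-inverseˡ , -P-inverseʳ
            ; ⁻¹-cong = ·P-cong refl }
          ; comm = +P-comm }
        ; *-cong = *P-cong
        ; *-assoc = *P-assoc
        ; *-identity = *P-identityˡ , *P-identityʳ
        ; distrib = *P-distribˡ , *P-distribʳ }
      ; *-comm = *P-comm }
    }

module FieldProperties {c ℓ : Level} (K : Field c ℓ) where

  open Field K
  open import Algebra.Properties.Ring ring using (-‿injective; -0#≈0#)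
  open import Algebra.Properties.CommutativeSemiring.Exp commutativeSemiring using (_^_)
  open import Algebra.Solver.Ring.NaturalCoefficients.Default commutativeSemiring
    using (solve; _:=_; _:*_)
  open import Relation.Binary.Reasoning.Setoid setoid

  x≉0∧x*y≈0⇒y≈0 : ∀ {x y} → ¬ x ≈ 0# → x * y ≈ 0# → y ≈ 0#
  x≉0∧x*y≈0⇒y≈0 {x} {y} x≉0 xy≈0 with inverse x x≉0
  ... | x⁻¹ , xx⁻¹≈1 = begin
    y              ≈⟨ *-identityˡ y ⟨
    1# * y         ≈⟨ *-congʳ xx⁻¹≈1 ⟨
    (x * x⁻¹) * y  ≈⟨ solve 3 (λ x x⁻¹ y → (x :* x⁻¹) :* y := x⁻¹ :* (x :* y))
                             refl x x⁻¹ y ⟩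
    x⁻¹ * (x * y)  ≈⟨ *-congˡ xy≈0 ⟩
    x⁻¹ * 0#       ≈⟨ zeroʳ x⁻¹ ⟩
    0#             ∎

  *-≉0 : ∀ {x y} → ¬ x ≈ 0# → ¬ y ≈ 0# → ¬ x * y ≈ 0#
  *-≉0 x≉0 y≉0 xy≈0 = y≉0 (x≉0∧x*y≈0⇒y≈0 x≉0 xy≈0)

  ^-≉0 : ∀ {x} n → ¬ x ≈ 0# → ¬ x ^ n ≈ 0#
  ^-≉0 zero    x≉0 = 1≉0
  ^-≉0 (suc n) x≉0 = *-≉0 x≉0 (^-≉0 n x≉0)

  -‿≉0 : ∀ {x} → ¬ x ≈ 0# → ¬ - x ≈ 0#
  -‿≉0 x≉0 -x≈0 = x≉0 (-‿injective (trans -x≈0 (sym -0#≈0#)))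

  x*y≈1⇒y≉0 : ∀ {x y} → x * y ≈ 1# → ¬ y ≈ 0#
  x*y≈1⇒y≉0 {x} xy≈1 y≈0 = 1≉0 (trans (sym xy≈1) (trans (*-congˡ y≈0) (zeroʳ x)))

module PolynomialDegree {c ℓ : Level} (K : Field c ℓ) where

  open Field K hiding (zero)
  open Poly K
  open PolynomialRing K
  open FieldProperties K
  open HornerReversal polynomialRing using (horner)
  open import Algebra.Properties.CommutativeSemiring.Exp commutativeSemiring using (_^_)
  open import Algebra.Solver.Ring.NaturalCoefficients.Default commutativeSemiring
    using (solve; _:=_; _:*_)

  C : Carrier → Pol
  C a = a ∷ []

  X : Pol
  X = 0# ∷ 1# ∷ []

  X*P≋0∷ : ∀ p → X *P p ≋ 0# ∷ p
  X*P≋0∷ p = +P-cong (0·P p) (∷-cong refl (*P-identityˡ p))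

  C*P≋·P : ∀ a p → C a *P p ≋ a ·P p
  C*P≋·P a p = ≋-trans (+P-cong {a ·P p} ≋-refl (∷-≋-[] refl ≋-refl)) (+P-identityʳ (a ·P p))

  C+PX*P≋∷ : ∀ a p → C a +P X *P p ≋ a ∷ p
  C+PX*P≋∷ a p = ≋-trans (+P-cong {C a} ≋-refl (X*P≋0∷ p)) (∷-cong (+-identityʳ a) ≋-refl)

  horner-C-X : ∀ m g → horner (applyDownFrom (C ∘ g) m) X ≋ applyDownFrom g m
  horner-C-X zero    g = ≋-refl
  horner-C-X (suc m) g =
    ≋-trans (+P-cong {C (g m)} ≋-refl (*P-congʳ X (horner-C-X m g))) (C+PX*P≋∷ (g m) _)

  ∘P≡horner : ∀ f h → f ∘P h ≡ horner (map C f) h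
  ∘P≡horner []      h = ≡.refl
  ∘P≡horner (a ∷ f) h = ≡.cong (λ t → C a +P h *P t) (∘P≡horner f h)

  ∘P-[] : ∀ {f} h → f ≋ [] → f ∘P h ≋ []
  ∘P-[] {[]}    h f≋[] = ≋-refl
  ∘P-[] {a ∷ f} h f≋[] =
    ≋-trans (+P-cong (∷-≋-[] (≋⇒≈P f≋[] 0) ≋-refl)
                     (≋-trans (*P-congʳ h (∘P-[] h (∷-≋-[]⇒≋ f≋[]))) (*P-zeroʳ h)))
            (+P-identityʳ [])

  ∘P-congˡ : ∀ {f f′} h → f ≋ f′ → f ∘P h ≋ f′ ∘P h
  ∘P-congˡ {[]}    {f′}     h f≋f′ = ≋-sym (∘P-[] h (≋-sym f≋f′))
  ∘P-congˡ {a ∷ f} {[]}     h f≋f′ = ∘P-[] h f≋f′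
  ∘P-congˡ {a ∷ f} {b ∷ f′} h f≋f′ =
    +P-cong (∷-cong (≋⇒≈P f≋f′ 0) ≋-refl) (*P-congʳ h (∘P-congˡ h (∷-≋-∷⇒≋ f≋f′)))

  degreeAtMost-cong : ∀ {p q} n → p ≋ q → DegreeAtMost p n → DegreeAtMost q n
  degreeAtMost-cong n p≋q deg i n<i = trans (sym (≋⇒≈P p≋q i)) (deg i n<i)

  degreeAtMost-tail : ∀ a p n → DegreeAtMost (a ∷ p) (suc n) → DegreeAtMost p n
  degreeAtMost-tail a p n deg i n<i = deg (suc i) (s≤s n<i)

  degreeAtMost-0⇒tail≋[] : ∀ a p → DegreeAtMost (a ∷ p) 0 → p ≋ []
  degreeAtMost-0⇒tail≋[] a p deg = ≈P⇒≋ λ i → deg (suc i) (s≤s z≤n)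

  degreeAtMost-length : ∀ p → DegreeAtMost p (length p)
  degreeAtMost-length []      i       _           = refl
  degreeAtMost-length (a ∷ p) (suc i) (s≤s len<i) = degreeAtMost-length p i len<i

  ·P-degreeAtMost : ∀ a p n → DegreeAtMost p n → DegreeAtMost (a ·P p) n
  ·P-degreeAtMost a p n deg i n<i = trans (coeff-·P a p i) (trans (*-congˡ (deg i n<i)) (zeroʳ a))

  ·P-hasDegree : ∀ a p n → ¬ a ≈ 0# → HasDegree p n → HasDegree (a ·P p) n
  ·P-hasDegree a p n a≉0 (lead , deg) =
    (λ e → *-≉0 a≉0 lead (trans (sym (coeff-·P a p n)) e)) , ·P-degreeAtMost a p n deg

  coeff-applyUpTo : ∀ n g i → i ℕ.< n → coeff (applyUpTo g n) i ≈ g i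
  coeff-applyUpTo (suc n) g zero    _         = refl
  coeff-applyUpTo (suc n) g (suc i) (s≤s i<n) = coeff-applyUpTo n (g ∘ suc) i i<n

  applyUpTo-degreeAtMost : ∀ n g → DegreeAtMost (applyUpTo g (suc n)) n
  applyUpTo-degreeAtMost zero    g (suc i) _         = refl
  applyUpTo-degreeAtMost (suc n) g (suc i) (s≤s n<i) = applyUpTo-degreeAtMost n (g ∘ suc) i n<i

  degreeAtMost⇒≋applyUpTo : ∀ f n → DegreeAtMost f n → f ≋ applyUpTo (coeff f) (suc n)
  degreeAtMost⇒≋applyUpTo f n deg = ≈P⇒≋ λ i → case i ℕ.≤? n of λ where
    (yes i≤n) → sym (coeff-applyUpTo (suc n) (coeff f) i (s≤s i≤n))
    (no  i≰n) → let n<i = ℕ.≰⇒> i≰n in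
                trans (deg i n<i) (sym (applyUpTo-degreeAtMost n (coeff f) i n<i))

  ∘P≋horner-applyUpTo : ∀ f d h → DegreeAtMost f d →
                        f ∘P h ≋ horner (applyUpTo (C ∘ coeff f) (suc d)) h
  ∘P≋horner-applyUpTo f d h degf = begin
    f ∘P h                                          ≈⟨ ∘P-congˡ h (degreeAtMost⇒≋applyUpTo f d degf) ⟩
    applyUpTo (coeff f) (suc d) ∘P h                ≡⟨ ∘P≡horner (applyUpTo (coeff f) (suc d)) h ⟩
    horner (map C (applyUpTo (coeff f) (suc d))) h
      ≡⟨ ≡.cong (λ L → horner L h) (map-applyUpTo (coeff f) C (suc d)) ⟩
    horner (applyUpTo (C ∘ coeff f) (suc d)) h      ∎
    where open ≋-Reasoning

  coeff-applyDownFrom-last : ∀ m g → coeff (applyDownFrom g (suc m)) m ≈ g 0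
  coeff-applyDownFrom-last zero    g = refl
  coeff-applyDownFrom-last (suc m) g = coeff-applyDownFrom-last m g

  applyDownFrom-degreeAtMost : ∀ m g → DegreeAtMost (applyDownFrom g (suc m)) m
  applyDownFrom-degreeAtMost zero    g (suc i) _         = refl
  applyDownFrom-degreeAtMost (suc m) g (suc i) (s≤s m<i) = applyDownFrom-degreeAtMost m g i m<i

  applyDownFrom-hasDegree : ∀ m g → ¬ g 0 ≈ 0# → HasDegree (applyDownFrom g (suc m)) m
  applyDownFrom-hasDegree m g g0≉0 =
    (λ e → g0≉0 (trans (sym (coeff-applyDownFrom-last m g)) e)) , applyDownFrom-degreeAtMost m g

  coeff-∷*P-[] : ∀ a p q i → p ≋ [] → coeff ((a ∷ p) *P q) i ≈ a * coeff q i
  coeff-∷*P-[] a p q i p≋[] = begin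
    coeff ((a ∷ p) *P q) i               ≈⟨ coeff-∷*P a p q i ⟩
    a * coeff q i + coeff (0# ∷ p *P q) i ≈⟨ +-congˡ (≋⇒≈P (∷-≋-[] refl (*P-[]ˡ q p≋[])) i) ⟩
    a * coeff q i + 0#                   ≈⟨ +-identityʳ _ ⟩
    a * coeff q i                        ∎
    where open ≈-Reasoning

  *P-degreeAtMost : ∀ p q m n → DegreeAtMost p m → DegreeAtMost q n →
                    DegreeAtMost (p *P q) (m ℕ.+ n)
  *P-degreeAtMost []      q m       n degp degq i _ = refl
  *P-degreeAtMost (a ∷ p) q zero    n degp degq i n<i = begin
    coeff ((a ∷ p) *P q) i  ≈⟨ coeff-∷*P-[] a p q i (degreeAtMost-0⇒tail≋[] a p degp) ⟩
    a * coeff q i           ≈⟨ *-congˡ (degq i n<i) ⟩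
    a * 0#                  ≈⟨ zeroʳ a ⟩
    0#                      ∎
    where open ≈-Reasoning
  *P-degreeAtMost (a ∷ p) q (suc m) n degp degq (suc i) (s≤s m+n<i) = begin
    coeff ((a ∷ p) *P q) (suc i)            ≈⟨ coeff-∷*P a p q (suc i) ⟩
    a * coeff q (suc i) + coeff (p *P q) i  ≈⟨ +-cong (*-congˡ (degq (suc i) n<1+i)) pq-deg ⟩
    a * 0# + 0#                             ≈⟨ trans (+-identityʳ _) (zeroʳ a) ⟩
    0#                                      ∎
    where
    open ≈-Reasoning
    n<1+i : n ℕ.< suc i
    n<1+i = ℕ.<-≤-trans (s≤s (ℕ.m≤n+m n m)) (ℕ.m≤n⇒m≤1+n m+n<i)
    pq-deg : coeff (p *P q) i ≈ 0#
    pq-deg = *P-degreeAtMost p q m n (degreeAtMost-tail a p m degp) degq i m+n<i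

  coeff-*P-top : ∀ p q m n → DegreeAtMost p m → DegreeAtMost q n →
                 coeff (p *P q) (m ℕ.+ n) ≈ coeff p m * coeff q n
  coeff-*P-top []      q m       n degp degq = sym (zeroˡ _)
  coeff-*P-top (a ∷ p) q zero    n degp degq = coeff-∷*P-[] a p q n (degreeAtMost-0⇒tail≋[] a p degp)
  coeff-*P-top (a ∷ p) q (suc m) n degp degq = begin
    coeff ((a ∷ p) *P q) (suc (m ℕ.+ n))
      ≈⟨ coeff-∷*P a p q (suc (m ℕ.+ n)) ⟩
    a * coeff q (suc (m ℕ.+ n)) + coeff (p *P q) (m ℕ.+ n)
      ≈⟨ +-cong (*-congˡ (degq _ (s≤s (ℕ.m≤n+m n m))))
                (coeff-*P-top p q m n (degreeAtMost-tail a p m degp) degq) ⟩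
    a * 0# + coeff p m * coeff q n
      ≈⟨ trans (+-congʳ (zeroʳ a)) (+-identityˡ _) ⟩
    coeff p m * coeff q n ∎
    where open ≈-Reasoning

  degreeAtMost-*P-cancelˡ : ∀ p q m n → HasDegree p m → DegreeAtMost (p *P q) (m ℕ.+ n) →
                            DegreeAtMost q n
  degreeAtMost-*P-cancelˡ p q m n (leadp , degp) degpq = lower (length q) (degreeAtMost-length q)
    where
    lower : ∀ M → DegreeAtMost q M → DegreeAtMost q n
    lower zero    degq i n<i = degq i (ℕ.≤-trans (s≤s z≤n) n<i)
    lower (suc M) degq with suc M ℕ.≤? n
    ... | yes 1+M≤n = λ i n<i → degq i (ℕ.≤-<-trans 1+M≤n n<i)
    ... | no  1+M≰n = lower M degq′
      where
      top≈0 : coeff q (suc M) ≈ 0#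
      top≈0 = x≉0∧x*y≈0⇒y≈0 leadp (trans (sym (coeff-*P-top p q m (suc M) degp degq))
                                         (degpq _ (ℕ.+-monoʳ-< m (ℕ.≰⇒> 1+M≰n))))
      degq′ : DegreeAtMost q M
      degq′ i M<i with ℕ.m≤n⇒m<n∨m≡n M<i
      ... | inj₁ 1+M<i  = degq i 1+M<i
      ... | inj₂ ≡.refl = top≈0

  ∷∘P-const : ∀ a f h → f ≋ [] → (a ∷ f) ∘P h ≋ C a
  ∷∘P-const a f h f≋[] = begin
    C a +P h *P (f ∘P h)  ≈⟨ +P-cong {C a} ≋-refl (*P-congʳ h (∘P-[] h f≋[])) ⟩
    C a +P h *P []        ≈⟨ +P-cong {C a} ≋-refl (*P-zeroʳ h) ⟩
    C a +P []             ≈⟨ +P-identityʳ (C a) ⟩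
    C a                   ∎
    where open ≋-Reasoning

  coeff-C+P-suc : ∀ a s i → coeff (C a +P s) (suc i) ≈ coeff s (suc i)
  coeff-C+P-suc a s i = trans (coeff-+P (C a) s (suc i)) (+-identityˡ _)

  ∘P-degreeAtMost : ∀ f h n e → DegreeAtMost f n → DegreeAtMost h (suc e) →
                    DegreeAtMost (f ∘P h) (n ℕ.* suc e)
  ∘P-degreeAtMost []      h n       e degf degh i _ = refl
  ∘P-degreeAtMost (a ∷ f) h zero    e degf degh =
    degreeAtMost-cong 0 (≋-sym (∷∘P-const a f h (degreeAtMost-0⇒tail≋[] a f degf)))
                        λ { (suc i) _ → refl }
  ∘P-degreeAtMost (a ∷ f) h (suc n) e degf degh (suc i) n′<1+i =
    trans (coeff-C+P-suc a (h *P (f ∘P h)) i)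
          (*P-degreeAtMost h (f ∘P h) (suc e) (n ℕ.* suc e) degh
            (∘P-degreeAtMost f h n e (degreeAtMost-tail a f n degf) degh) (suc i) n′<1+i)

  coeff-∘P-top : ∀ f h n e → DegreeAtMost f n → DegreeAtMost h (suc e) →
                 coeff (f ∘P h) (n ℕ.* suc e) ≈ coeff f n * coeff h (suc e) ^ n
  coeff-∘P-top []      h n       e degf degh = sym (zeroˡ _)
  coeff-∘P-top (a ∷ f) h zero    e degf degh =
    trans (≋⇒≈P (∷∘P-const a f h (degreeAtMost-0⇒tail≋[] a f degf)) 0) (sym (*-identityʳ a))
  coeff-∘P-top (a ∷ f) h (suc n) e degf degh = begin
    coeff ((a ∷ f) ∘P h) (suc e ℕ.+ n ℕ.* suc e)
      ≈⟨ coeff-C+P-suc a (h *P (f ∘P h)) (e ℕ.+ n ℕ.* suc e) ⟩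
    coeff (h *P (f ∘P h)) (suc e ℕ.+ n ℕ.* suc e)
      ≈⟨ coeff-*P-top h (f ∘P h) (suc e) (n ℕ.* suc e) degh (∘P-degreeAtMost f h n e degf′ degh) ⟩
    hₑ * coeff (f ∘P h) (n ℕ.* suc e)
      ≈⟨ *-congˡ (coeff-∘P-top f h n e degf′ degh) ⟩
    hₑ * (coeff f n * hₑ ^ n)
      ≈⟨ solve 3 (λ x a p → x :* (a :* p) := a :* (x :* p)) refl hₑ (coeff f n) (hₑ ^ n) ⟩
    coeff f n * (hₑ * hₑ ^ n) ∎
    where
    open ≈-Reasoning
    hₑ : Carrier
    hₑ = coeff h (suc e)
    degf′ : DegreeAtMost f n
    degf′ = degreeAtMost-tail a f n degf

  ∘P-hasDegree : ∀ f h n e → HasDegree f n → HasDegree h (suc e) →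
                 HasDegree (f ∘P h) (n ℕ.* suc e)
  ∘P-hasDegree f h n e (leadf , degf) (leadh , degh) =
    (λ top≈0 → *-≉0 leadf (^-≉0 n leadh) (trans (sym (coeff-∘P-top f h n e degf degh)) top≈0)) ,
    ∘P-degreeAtMost f h n e degf degh

  *P-reducible : ∀ p q r m n → HasDegree p (suc m) → HasDegree r (suc m ℕ.+ suc n) →
                 r ≋ p *P q → Reducible r
  *P-reducible p q r m n (leadp , degp) (leadr , degr) r≋pq =
    p , q , (suc m , s≤s z≤n , leadp) , (suc n , s≤s z≤n , leadq) , ≋⇒≈P r≋pq
    where
    degq : DegreeAtMost q (suc n)
    degq = degreeAtMost-*P-cancelˡ p q (suc m) (suc n) (leadp , degp) (degreeAtMost-cong _ r≋pq degr)
    leadq : ¬ coeff q (suc n) ≈ 0#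
    leadq q≈0 = leadr (begin
      coeff r (suc m ℕ.+ suc n)        ≈⟨ ≋⇒≈P r≋pq _ ⟩
      coeff (p *P q) (suc m ℕ.+ suc n) ≈⟨ coeff-*P-top p q (suc m) (suc n) degp degq ⟩
      coeff p (suc m) * coeff q (suc n) ≈⟨ *-congˡ q≈0 ⟩
      coeff p (suc m) * 0#              ≈⟨ zeroʳ _ ⟩
      0#                                ∎)
      where open ≈-Reasoning

module ReversalConstruction {c ℓ : Level} (K : Field c ℓ) where

  open Field K hiding (zero)
  open Poly K
  open PolynomialRing K
  open FieldProperties K
  open PolynomialDegree K
  open HornerReversal polynomialRing using (horner; reversal-divides-horner)

  -- The coefficient list [a_d, …, a₀], i.e. X^d f(1/X) for f of degree at most d.
  reversal : Pol → ℕ → Pol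
  reversal f d = applyDownFrom (coeff f) (suc d)

  irreducible⇒coeff₀≉0 : ∀ f n → HasDegree f (suc (suc n)) → Irreducible f → ¬ coeff f 0 ≈ 0#
  irreducible⇒coeff₀≉0 []      n (lead , _) _   _   = lead refl
  irreducible⇒coeff₀≉0 (a ∷ f) n (lead , _) (_ , irr) a≈0
    with irr X f (≋⇒≈P (≋-trans (∷-cong a≈0 ≋-refl) (≋-sym (X*P≋0∷ f))))
  ... | inj₁ (_ , X-const) = 1≉0 (X-const 1 (s≤s z≤n))
  ... | inj₂ (_ , f-const) = lead (f-const (suc n) (s≤s z≤n))

  X-bezout : ∀ {a b} p → b * a ≈ 1# → ((- b) ·P p) *P X +P C b *P (a ∷ p) ≋ 1P
  X-bezout {a} {b} p ba≈1 = begin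
    ((- b) ·P p) *P X +P C b *P (a ∷ p)
      ≈⟨ +P-cong (≋-trans (*P-comm _ X) (X*P≋0∷ _)) (C*P≋·P b (a ∷ p)) ⟩
    (0# + b * a) ∷ ((- b) ·P p +P b ·P p)
      ≈⟨ ∷-cong (trans (+-identityˡ _) ba≈1) (≋-sym (·P-distribʳ p (- b) b)) ⟩
    1# ∷ ((- b + b) ·P p)
      ≈⟨ ∷-cong refl (≋-trans (·P-cong (-‿inverseˡ b) ≋-refl) (0·P p)) ⟩
    1P ∎
    where open ≋-Reasoning

  X⁻¹-mod-reversal : Pol → ℕ → Carrier → Pol
  X⁻¹-mod-reversal f d b = (- b) ·P applyDownFrom (coeff f) d

  X⁻¹-mod-reversal-bezout : ∀ f d {b} → b * coeff f d ≈ 1# →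
    X⁻¹-mod-reversal f d b *P X +P C b *P horner (applyDownFrom (C ∘ coeff f) (suc d)) X ≋ 1P
  X⁻¹-mod-reversal-bezout f d {b} bad≈1 = ≋-trans
    (+P-cong {X⁻¹-mod-reversal f d b *P X} ≋-refl (*P-congʳ (C b) (horner-C-X (suc d) (coeff f))))
    (X-bezout (applyDownFrom (coeff f) d) bad≈1)

  reversal-divides-∘P : ∀ f d {b} → DegreeAtMost f d → b * coeff f d ≈ 1# →
    ∃[ k ] f ∘P X⁻¹-mod-reversal f d b ≋ reversal f d *P k
  reversal-divides-∘P f d {b} degf bad≈1 =
    let k , eq = divides in
    k , ≋-trans (∘P≋horner-applyUpTo f d h degf)
                (≋-trans eq (*P-congˡ k (horner-C-X (suc d) (coeff f))))
    where
    h : Pol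
    h = X⁻¹-mod-reversal f d b
    divides : ∃[ k ] horner (applyUpTo (C ∘ coeff f) (suc d)) h
                     ≋ horner (applyDownFrom (C ∘ coeff f) (suc d)) X *P k
    divides = reversal-divides-horner {X} {h} {C b} d (C ∘ coeff f)
                (X⁻¹-mod-reversal-bezout f d bad≈1)

  reducible-composition : ∀ f k → HasDegree f (3 ℕ.+ k) → Irreducible f →
    ∃[ h ] (DegreeAtMost h (2 ℕ.+ k) × Reducible (f ∘P h))
  reducible-composition f k f-deg@(lc≉0 , degf) f-irr =
    let cofactor , fh≋f*·cofactor = reversal-divides-∘P f d degf lc⁻¹*lc≈1 in
    h , proj₂ h-deg ,
    *P-reducible (reversal f d) cofactor (f ∘P h) (2 ℕ.+ k) _ f*-deg fh-deg fh≋f*·cofactor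
    where
    d : ℕ
    d = 3 ℕ.+ k
    a₀≉0 : ¬ coeff f 0 ≈ 0#
    a₀≉0 = irreducible⇒coeff₀≉0 f (suc k) f-deg f-irr
    lc⁻¹ : Carrier
    lc⁻¹ = proj₁ (inverse (coeff f d) lc≉0)
    lc*lc⁻¹≈1 : coeff f d * lc⁻¹ ≈ 1#
    lc*lc⁻¹≈1 = proj₂ (inverse (coeff f d) lc≉0)
    lc⁻¹*lc≈1 : lc⁻¹ * coeff f d ≈ 1#
    lc⁻¹*lc≈1 = trans (*-comm lc⁻¹ _) lc*lc⁻¹≈1
    f*-deg : HasDegree (reversal f d) d
    f*-deg = applyDownFrom-hasDegree d (coeff f) a₀≉0
    h : Pol
    h = X⁻¹-mod-reversal f d lc⁻¹
    h-deg : HasDegree h (2 ℕ.+ k)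
    h-deg = ·P-hasDegree (- lc⁻¹) (applyDownFrom (coeff f) d) (2 ℕ.+ k)
              (-‿≉0 (x*y≈1⇒y≉0 lc*lc⁻¹≈1)) (applyDownFrom-hasDegree (2 ℕ.+ k) (coeff f) a₀≉0)
    fh-deg : HasDegree (f ∘P h) (d ℕ.+ d ℕ.* suc k)
    fh-deg = ≡.subst (HasDegree (f ∘P h)) (ℕ.*-suc d (suc k)) (∘P-hasDegree f h d (suc k) f-deg h-deg)

mainTheorem1 : ∀ {c ℓ} (K : Field c ℓ) → let open Poly K in
    ∀ (f : Pol) (d : ℕ) → 3 ≤ d → HasDegree f d → Irreducible f →
    ∃[ h ] (DegreeAtMost h (d ∸ 1) × Reducible (f ∘P h))
mainTheorem1 K f (suc (suc (suc k))) (s≤s (s≤s (s≤s z≤n))) =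
  ReversalConstruction.reducible-composition K f k
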